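{- Let $G$ be a finite group and $A$ an ambivalent finite group. Then $$k^*(G\times A)=(k^*(A)+1)(k^*(G)+1)-1.$$ In particular, $k^*(G\times\mathbb{Z}_2^r)=2^r(k^*(G)+1)-1$ for every $r\in\mathbb{N}_0$.
   Context: $c(G)$ is the number of conjugacy classes of a group $G$ and $c_2(G)$ the number of real conjugacy classes (classes $C_g$ with $C_g=C_{g^{ -1}}$); $k^*(G)=\tfrac12\{c(G)+c_2(G)\}-1$. A group is ambivalent if every element is conjugate to its inverse (so $k^*(A)=c(A)-1$ for ambivalent $A$). -}

module Defs where

open import Level using (Level; _⊔_; 0ℓ)
open import Algebra.Bundles using (Group)
import Algebra.Construct.DirectProduct as DP
import Algebra.Construct.Terminal as Terminal
open import Data.Bool using (Bool; true; false; _xor_)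
open import Data.Nat using (ℕ; zero; suc; _+_; _∸_; _/_)
open import Data.List using (List; []; _∷_; length; filter; cartesianProduct)
open import Data.List.Relation.Unary.Any using (Any; here; there; any?)
open import Data.List.Relation.Unary.Any.Properties using (cartesianProduct⁺)
open import Data.Product using (_×_; _,_; ∃-syntax)
open import Data.Product.Relation.Binary.Pointwise.NonDependent using (Pointwise)
open import Data.Unit.Polymorphic using (tt)
open import Relation.Binary.Definitions using (Decidable)
open import Relation.Nullary using (Dec; yes; no; ¬_)
import Relation.Nullary.Decidable as Dec
import Data.Bool.ListAction
open import Relation.Binary.PropositionalEquality using (_≡_; refl; isEquivalence; cong₂)

private variable a b a′ b′ : Level

-- Finite groups: a (setoid-based) stdlib Group together with decidable
-- equality and a finite list enumerating every element (up to ≈;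
-- duplicates are allowed).

record FiniteGroup (c ℓ : Level) : Set (Level.suc (c ⊔ ℓ)) where
  field
    group    : Group c ℓ
  open Group group public
  field
    _≟_      : Decidable _≈_
    elements : List Carrier
    complete : ∀ x → Any (x ≈_) elements

module _ (G : FiniteGroup a b) where
  open FiniteGroup G

  Conj : Carrier → Carrier → Set (a ⊔ b)
  Conj g h = ∃[ x ] (x ∙ g ∙ x ⁻¹ ≈ h)

  conj? : Carrier → Carrier → Bool
  conj? g h = Dec.isYes (any? (λ x → (x ∙ g ∙ x ⁻¹) ≟ h) elements)

  real? : Carrier → Bool
  real? g = conj? g (g ⁻¹)

  reps : List Carrier → List Carrier → List Carrier
  reps seen []       = []
  reps seen (x ∷ xs) with Data.Bool.ListAction.any (λ y → conj? y x) seen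
  ... | true  = reps seen xs
  ... | false = x ∷ reps (x ∷ seen) xs

  c : ℕ
  c = length (reps [] elements)

  c₂ : ℕ
  c₂ = length (filter (λ g → Dec.T? (real? g)) (reps [] elements))

  -- k*(G) = ½(c(G) + c₂(G)) − 1   (c + c₂ is always even and ≥ 2)
  kstar : ℕ
  kstar = ((c + c₂) / 2) ∸ 1

  Ambivalent : Set (a ⊔ b)
  Ambivalent = ∀ g → Conj g (g ⁻¹)

infixr 6 _×ᶠ_
_×ᶠ_ : FiniteGroup a b → FiniteGroup a′ b′ → FiniteGroup (a ⊔ a′) (b ⊔ b′)
G ×ᶠ H = record
  { group    = DP.group G.group H.group
  ; _≟_      = λ { (x , y) (x′ , y′) → Dec.map′ (λ { (p , q) → p , q }) (λ { (p , q) → p , q })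
                                         (G._≟_ x x′ Relation.Nullary.×-dec H._≟_ y y′) }
  ; elements = cartesianProduct G.elements H.elements
  ; complete = λ { (x , y) → cartesianProduct⁺ (G.complete x) (H.complete y) }
  }
  where module G = FiniteGroup G
        module H = FiniteGroup H
        import Relation.Nullary

private
  xor-assoc : ∀ x y z → (x xor y) xor z ≡ x xor (y xor z)
  xor-assoc false y z = refl
  xor-assoc true false z = refl
  xor-assoc true true false = refl
  xor-assoc true true true = refl

  xor-idˡ : ∀ x → false xor x ≡ x
  xor-idˡ x = refl
  xor-idʳ : ∀ x → x xor false ≡ x
  xor-idʳ false = refl
  xor-idʳ true = refl
  xor-self : ∀ x → x xor x ≡ false
  xor-self false = refl
  xor-self true = refl

ℤ₂-group : Group 0ℓ 0ℓ
ℤ₂-group = record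
  { Carrier = Bool ; _≈_ = _≡_ ; _∙_ = _xor_ ; ε = false ; _⁻¹ = λ x → x
  ; isGroup = record
    { isMonoid = record
      { isSemigroup = record
        { isMagma = record { isEquivalence = isEquivalence ; ∙-cong = cong₂ _xor_ }
        ; assoc = xor-assoc }
      ; identity = xor-idˡ , xor-idʳ }
    ; inverse = xor-self , xor-self
    ; ⁻¹-cong = λ p → p }
  }

ℤ₂ : FiniteGroup 0ℓ 0ℓ
ℤ₂ = record
  { group    = ℤ₂-group
  ; _≟_      = Data.Bool._≟_
  ; elements = false ∷ true ∷ []
  ; complete = λ { false → here refl ; true → there (here refl) }
  }
  where import Data.Bool

trivialGroup : FiniteGroup 0ℓ 0ℓ
trivialGroup = record
  { group    = Terminal.group
  ; _≟_      = λ _ _ → yes tt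
  ; elements = tt ∷ []
  ; complete = λ _ → here tt
  }

ℤ₂^_ : ℕ → FiniteGroup 0ℓ 0ℓ
ℤ₂^ zero  = trivialGroup
ℤ₂^ suc r = ℤ₂ ×ᶠ (ℤ₂^ r)

{-# OPTIONS --safe #-}
module Submission where

-- Conjugacy classes of G × A are products of classes, so c(G × A) = c(G) c(A); a class of
-- G × A is real iff both factors are, and when A is ambivalent every class of A is real, so
-- c₂(G × A) = c₂(G) c(A).  Inversion is a fixed-point-free involution on the non-real classes,
-- so c(G) − c₂(G) is even and c(G) + c₂(G) = 2 (k*(G) + 1) exactly.  Hence
-- 2 (k*(G × A) + 1) = (c(G) + c₂(G)) c(A) = 2 (k*(G) + 1) (k*(A) + 1).

open import Defs
open import Level using (Level; _⊔_)
open import Data.Bool using (true; false; T)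
open import Data.Bool.ListAction using (any)
open import Data.Nat using (ℕ; zero; suc; _+_; _*_; _≤_; _∸_; _/_; _^_; z≤n; s≤s)
open import Data.Nat.Properties
  using (≤-antisym; ≤-refl; ≤-reflexive; ≤-trans; n≤1+n; m≤m+n; +-suc; +-comm; +-identityʳ; *-comm; *-assoc;
         *-distribʳ-+; *-cancelˡ-≡; m+n∸n≡m; module ≤-Reasoning)
open import Data.Nat.DivMod using (m*n/n≡m)
open import Data.Nat.Divisibility using (_∣_; divides; _∣0; ∣-refl; ∣m∣n⇒∣m+n)
open import Data.Nat.Tactic.RingSolver using (solve-∀)
open import Data.List using (List; []; _∷_; length; filter; cartesianProduct; map)
open import Data.List.Properties using (length-removeAt′; length-++; length-map)
open import Data.List.Relation.Unary.Any using (Any; here; there; _─_; index; satisfied)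
import Data.List.Relation.Unary.Any as Any
open import Data.List.Relation.Unary.Any.Properties using (any⁺; any⁻)
open import Data.List.Relation.Unary.All using (All; []; _∷_)
import Data.List.Relation.Unary.All as All
open import Data.List.Relation.Unary.All.Properties using (─⁺)
open import Data.List.Relation.Unary.AllPairs using ([]; _∷_)
import Data.List.Membership.Setoid as Membership
open import Data.List.Membership.Setoid.Properties
  using (∈-resp-≈; All[≉]⇒∉; ∈-filter⁺; ∈-filter⁻; ∈-length; ∈-cartesianProductWith⁺; ∈-cartesianProductWith⁻)
import Data.List.Relation.Unary.Unique.Setoid as UniqueSetoid
open import Data.List.Relation.Unary.Unique.Setoid.Properties using (filter⁺; cartesianProductWith⁺)
import Data.List.Relation.Binary.Subset.Setoid as Subset
open import Data.Product using (_×_; _,_; proj₁; proj₂)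
open import Data.Sum using (_⊎_; inj₁; inj₂)
open import Data.Empty using (⊥-elim)
open import Function using (_∘_; Congruent)
open import Relation.Nullary using (¬_; does)
open import Relation.Nullary.Decidable using (T?; toWitness; fromWitness)
open import Relation.Unary using (Pred; Decidable)
open import Relation.Unary.Properties using (∁?)
open import Relation.Binary.Bundles using (Setoid)
import Relation.Binary.PropositionalEquality as ≡
open ≡ using (_≡_; module ≡-Reasoning)

private variable a p : Level

m≡n*2⇒m/2∸1+1≡n : ∀ {m} n → m ≡ n * 2 → 1 ≤ m → m / 2 ∸ 1 + 1 ≡ n
m≡n*2⇒m/2∸1+1≡n zero    ≡.refl ()
m≡n*2⇒m/2∸1+1≡n (suc n) ≡.refl _ = ≡.trans (≡.cong (λ k → k ∸ 1 + 1) (m*n/n≡m (suc n) 2)) (+-comm n 1)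

m+1≡n⇒m≡n∸1 : ∀ {m n} → m + 1 ≡ n → m ≡ n ∸ 1
m+1≡n⇒m≡n∸1 {m} m+1≡n = ≡.trans (≡.sym (m+n∸n≡m m 1)) (≡.cong (_∸ 1) m+1≡n)

length-cartesianProduct : ∀ {b} {A : Set a} {B : Set b} (xs : List A) (ys : List B) →
                          length (cartesianProduct xs ys) ≡ length xs * length ys
length-cartesianProduct []       ys = ≡.refl
length-cartesianProduct (x ∷ xs) ys = ≡.trans (length-++ (map (x ,_) ys))
  (≡.cong₂ _+_ (length-map (x ,_) ys) (length-cartesianProduct xs ys))

module _ {A : Set a} {P : Pred A p} (P? : Decidable P) where

  length-filter+filter-∁ : ∀ xs → length (filter P? xs) + length (filter (∁? P?) xs) ≡ length xs
  length-filter+filter-∁ []       = ≡.refl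
  length-filter+filter-∁ (x ∷ xs) with does (P? x)
  ... | true  = ≡.cong suc (length-filter+filter-∁ xs)
  ... | false = ≡.trans (+-suc _ _) (≡.cong suc (length-filter+filter-∁ xs))

module Counting {c ℓ} (S : Setoid c ℓ) where

  open Setoid S
  open Membership S using (_∈_; _∉_)
  open UniqueSetoid S using (Unique)
  open Subset S using (_⊆_)

  ∈-─⁺ : ∀ {v w xs} (p : v ∈ xs) → w ∈ xs → ¬ w ≈ v → w ∈ (xs ─ p)
  ∈-─⁺ (here v≈x) (here w≈x) w≉v = ⊥-elim (w≉v (trans w≈x (sym v≈x)))
  ∈-─⁺ (here _)   (there w∈xs) _  = w∈xs
  ∈-─⁺ (there _)  (here w≈x) _    = here w≈x
  ∈-─⁺ (there p)  (there w∈xs) w≉v = there (∈-─⁺ p w∈xs w≉v)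

  ∈-─⁻ : ∀ {p} {P : Pred Carrier p} {w xs} (p : Any P xs) → w ∈ (xs ─ p) → w ∈ xs
  ∈-─⁻ (here _)  w∈xs         = there w∈xs
  ∈-─⁻ (there _) (here w≈x)   = here w≈x
  ∈-─⁻ (there p) (there w∈xs) = there (∈-─⁻ p w∈xs)

  Unique-─ : ∀ {p} {P : Pred Carrier p} {xs} → Unique xs → (p : Any P xs) → Unique (xs ─ p)
  Unique-─ (_ ∷ xs!)       (here _)  = xs!
  Unique-─ (x≉xs ∷ xs!) (there p) = ─⁺ p x≉xs ∷ Unique-─ xs! p

  ∉-─ : ∀ {v xs} → Unique xs → (p : v ∈ xs) → v ∉ (xs ─ p)
  ∉-─ (x≉xs ∷ _)   (here v≈x) v∈xs = All[≉]⇒∉ S x≉xs (∈-resp-≈ S v≈x v∈xs)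
  ∉-─ (x≉xs ∷ _)   (there p) (here v≈x)   = All[≉]⇒∉ S x≉xs (∈-resp-≈ S v≈x p)
  ∉-─ (_ ∷ xs!)    (there p) (there v∈xs) = ∉-─ xs! p v∈xs

  Unique-⊆⇒length≤ : ∀ {xs ys} → Unique xs → xs ⊆ ys → length xs ≤ length ys
  Unique-⊆⇒length≤ {[]}     _            _       = z≤n
  Unique-⊆⇒length≤ {x ∷ xs} {ys} (x≉xs ∷ xs!) x∷xs⊆ys = begin
    suc (length xs)         ≤⟨ s≤s (Unique-⊆⇒length≤ xs! xs⊆ys─x) ⟩
    suc (length (ys ─ x∈ys)) ≡⟨ ≡.sym (length-removeAt′ ys (index x∈ys)) ⟩
    length ys               ∎
    where
    open ≤-Reasoning
    x∈ys : x ∈ ys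
    x∈ys = x∷xs⊆ys (here refl)
    xs⊆ys─x : xs ⊆ (ys ─ x∈ys)
    xs⊆ys─x y∈xs = ∈-─⁺ x∈ys (x∷xs⊆ys (there y∈xs)) (λ y≈x → All[≉]⇒∉ S x≉xs (∈-resp-≈ S y≈x y∈xs))

  Unique-⊆-⊇⇒length≡ : ∀ {xs ys} → Unique xs → Unique ys → xs ⊆ ys → ys ⊆ xs → length xs ≡ length ys
  Unique-⊆-⊇⇒length≡ xs! ys! xs⊆ys ys⊆xs =
    ≤-antisym (Unique-⊆⇒length≤ xs! xs⊆ys) (Unique-⊆⇒length≤ ys! ys⊆xs)

  module _ {f : Carrier → Carrier} (f-cong : Congruent _≈_ _≈_ f) (f-involutive : ∀ x → f (f x) ≈ x) where

    Unique-involution-closed⇒2∣length : ∀ {xs} → Unique xs → (∀ {x} → x ∈ xs → ¬ f x ≈ x) →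
                                       (∀ {x} → x ∈ xs → f x ∈ xs) → 2 ∣ length xs
    Unique-involution-closed⇒2∣length {xs} = go (length xs) xs ≤-refl
      where
      -- n bounds the length: the recursive call is on xs with x and f x removed, not a subterm.
      f-injective : ∀ {x y} → f x ≈ f y → x ≈ y
      f-injective fx≈fy = trans (sym (f-involutive _)) (trans (f-cong fx≈fy) (f-involutive _))

      go : ∀ n xs → length xs ≤ n → Unique xs → (∀ {x} → x ∈ xs → ¬ f x ≈ x) →
           (∀ {x} → x ∈ xs → f x ∈ xs) → 2 ∣ length xs
      go _       []       _            _            _     _      = 2 ∣0
      go (suc n) (x ∷ xs) (s≤s |xs|≤n) (x≉xs ∷ xs!) fp-free closed =
        ≡.subst (2 ∣_) (≡.cong suc (≡.sym |xs|≡1+|rest|)) (∣m∣n⇒∣m+n ∣-refl 2∣|rest|)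
        where
        fx∈xs : f x ∈ xs
        fx∈xs with closed (here refl)
        ... | here fx≈x  = ⊥-elim (fp-free (here refl) fx≈x)
        ... | there fx∈xs = fx∈xs
        rest : List Carrier
        rest = xs ─ fx∈xs
        |xs|≡1+|rest| : length xs ≡ suc (length rest)
        |xs|≡1+|rest| = length-removeAt′ xs (index fx∈xs)
        rest-closed : ∀ {y} → y ∈ rest → f y ∈ rest
        rest-closed {y} y∈ with closed (there (∈-─⁻ fx∈xs y∈))
        ... | here fy≈x   = ⊥-elim (∉-─ xs! fx∈xs (∈-resp-≈ S (trans (sym (f-involutive y)) (f-cong fy≈x)) y∈))
        ... | there fy∈xs = ∈-─⁺ fx∈xs fy∈xs
                              (λ fy≈fx → All[≉]⇒∉ S x≉xs (∈-resp-≈ S (f-injective fy≈fx) (∈-─⁻ fx∈xs y∈)))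
        2∣|rest| : 2 ∣ length rest
        2∣|rest| = go n rest (≤-trans (n≤1+n _) (≤-trans (≤-reflexive (≡.sym |xs|≡1+|rest|)) |xs|≤n))
                     (Unique-─ xs! fx∈xs) (λ y∈ → fp-free (there (∈-─⁻ fx∈xs y∈))) rest-closed
      go zero    (_ ∷ _)  ()           _            _     _

open Counting using (Unique-⊆-⊇⇒length≡; Unique-involution-closed⇒2∣length)

module Conjugacy {a b} (G : FiniteGroup a b) where

  open FiniteGroup G
  open import Algebra.Properties.Group group using (ε⁻¹≈ε; ⁻¹-anti-homo-∙; ⁻¹-involutive)
  open import Relation.Binary.Reasoning.Setoid setoid

  conj : Carrier → Carrier → Carrier
  conj x g = x ∙ g ∙ x ⁻¹

  conj-ε : ∀ g → conj ε g ≈ g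
  conj-ε g = begin
    ε ∙ g ∙ ε ⁻¹ ≈⟨ ∙-congˡ ε⁻¹≈ε ⟩
    ε ∙ g ∙ ε    ≈⟨ identityʳ _ ⟩
    ε ∙ g        ≈⟨ identityˡ g ⟩
    g            ∎

  conj-∙ : ∀ y x g → conj (y ∙ x) g ≈ conj y (conj x g)
  conj-∙ y x g = begin
    y ∙ x ∙ g ∙ (y ∙ x) ⁻¹        ≈⟨ ∙-cong (assoc y x g) (⁻¹-anti-homo-∙ y x) ⟩
    y ∙ (x ∙ g) ∙ (x ⁻¹ ∙ y ⁻¹)   ≈⟨ assoc _ _ _ ⟨
    y ∙ (x ∙ g) ∙ x ⁻¹ ∙ y ⁻¹     ≈⟨ ∙-congʳ (assoc _ _ _) ⟩
    y ∙ (x ∙ g ∙ x ⁻¹) ∙ y ⁻¹     ∎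

  conj-congˡ : ∀ {x x′} g → x ≈ x′ → conj x g ≈ conj x′ g
  conj-congˡ g x≈x′ = ∙-cong (∙-congʳ x≈x′) (⁻¹-cong x≈x′)

  conj-congʳ : ∀ x {g g′} → g ≈ g′ → conj x g ≈ conj x g′
  conj-congʳ x g≈g′ = ∙-congʳ (∙-congˡ g≈g′)

  conj-⁻¹ : ∀ x g → conj x (g ⁻¹) ≈ conj x g ⁻¹
  conj-⁻¹ x g = begin
    x ∙ g ⁻¹ ∙ x ⁻¹         ≈⟨ assoc _ _ _ ⟩
    x ∙ (g ⁻¹ ∙ x ⁻¹)       ≈⟨ ∙-cong (⁻¹-involutive x) (⁻¹-anti-homo-∙ x g) ⟨
    x ⁻¹ ⁻¹ ∙ (x ∙ g) ⁻¹    ≈⟨ ⁻¹-anti-homo-∙ _ _ ⟨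
    (x ∙ g ∙ x ⁻¹) ⁻¹       ∎

  ≈⇒Conj : ∀ {g h} → g ≈ h → Conj G g h
  ≈⇒Conj g≈h = ε , trans (conj-ε _) g≈h

  Conj-refl : ∀ {g} → Conj G g g
  Conj-refl = ≈⇒Conj refl

  Conj-sym : ∀ {g h} → Conj G g h → Conj G h g
  Conj-sym {g} {h} (x , xgx⁻¹≈h) = x ⁻¹ , (begin
    conj (x ⁻¹) h          ≈⟨ conj-congʳ (x ⁻¹) xgx⁻¹≈h ⟨
    conj (x ⁻¹) (conj x g) ≈⟨ conj-∙ _ _ _ ⟨
    conj (x ⁻¹ ∙ x) g      ≈⟨ conj-congˡ g (inverseˡ x) ⟩
    conj ε g               ≈⟨ conj-ε g ⟩
    g                      ∎)

  Conj-trans : ∀ {g h k} → Conj G g h → Conj G h k → Conj G g k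
  Conj-trans {g} (x , e₁) (y , e₂) = y ∙ x , trans (conj-∙ y x g) (trans (conj-congʳ y e₁) e₂)

  Conj-⁻¹ : ∀ {g h} → Conj G g h → Conj G (g ⁻¹) (h ⁻¹)
  Conj-⁻¹ {g} (x , e) = x , trans (conj-⁻¹ x g) (⁻¹-cong e)

  conjSetoid : Setoid a (a ⊔ b)
  conjSetoid = record
    { Carrier = Carrier ; _≈_ = Conj G
    ; isEquivalence = record { refl = Conj-refl ; sym = Conj-sym ; trans = Conj-trans } }

  open Membership conjSetoid public using (_∈_; _∉_)
  open UniqueSetoid conjSetoid public using (Unique)

  conj?-sound : ∀ {g h} → T (conj? G g h) → Conj G g h
  conj?-sound = satisfied ∘ toWitness

  conj?-complete : ∀ {g h} → Conj G g h → T (conj? G g h)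
  conj?-complete {g} (x , e) = fromWitness (Any.map (λ x≈y → trans (conj-congˡ g (sym x≈y)) e) (complete x))

  Real : Carrier → Set (a ⊔ b)
  Real g = Conj G g (g ⁻¹)

  Real-resp-Conj : ∀ {g h} → Conj G g h → Real g → Real h
  Real-resp-Conj g~h g-real = Conj-trans (Conj-sym g~h) (Conj-trans g-real (Conj-⁻¹ g~h))

  Real-⁻¹ : ∀ {g} → Real (g ⁻¹) → Real g
  Real-⁻¹ {g} g⁻¹-real = Conj-trans (≈⇒Conj (sym (⁻¹-involutive g))) (Conj-sym g⁻¹-real)

  reps-fresh : ∀ seen xs → All (_∉ seen) (reps G seen xs)
  reps-fresh seen []       = []
  reps-fresh seen (x ∷ xs) with any (λ y → conj? G y x) seen in eq
  ... | true  = reps-fresh seen xs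
  ... | false = x∉seen ∷ All.map (_∘ there) (reps-fresh (x ∷ seen) xs)
    where
    x∉seen : x ∉ seen
    x∉seen x∈seen = ≡.subst T eq (any⁺ _ (Any.map (conj?-complete ∘ Conj-sym) x∈seen))

  reps-unique : ∀ seen xs → Unique (reps G seen xs)
  reps-unique seen []       = []
  reps-unique seen (x ∷ xs) with any (λ y → conj? G y x) seen
  ... | true  = reps-unique seen xs
  ... | false = All.map (λ r∉x∷seen x~r → r∉x∷seen (here (Conj-sym x~r))) (reps-fresh (x ∷ seen) xs)
                ∷ reps-unique (x ∷ seen) xs

  ∈-reps : ∀ seen xs {g} → g ∈ xs → g ∈ seen ⊎ g ∈ reps G seen xs
  ∈-reps seen (x ∷ xs) g∈x∷xs with any (λ y → conj? G y x) seen in eq | g∈x∷xs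
  ... | true  | here g~x    = inj₁ (Any.map (λ t → Conj-trans g~x (Conj-sym (conj?-sound t)))
                                            (any⁻ _ seen (≡.subst T (≡.sym eq) _)))
  ... | true  | there g∈xs = ∈-reps seen xs g∈xs
  ... | false | here g~x    = inj₂ (here g~x)
  ... | false | there g∈xs with ∈-reps (x ∷ seen) xs g∈xs
  ...   | inj₁ (here g~x)    = inj₂ (here g~x)
  ...   | inj₁ (there g∈seen) = inj₁ g∈seen
  ...   | inj₂ g∈reps        = inj₂ (there g∈reps)

  classReps : List Carrier
  classReps = reps G [] elements

  ∈-classReps : ∀ g → g ∈ classReps
  ∈-classReps g with ∈-reps [] elements (Any.map ≈⇒Conj (complete g))
  ... | inj₂ g∈classReps = g∈classReps

  classReps-unique : Unique classReps
  classReps-unique = reps-unique [] elements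

  realReps : List Carrier
  realReps = filter (T? ∘ real? G) classReps

  nonrealReps : List Carrier
  nonrealReps = filter (∁? (T? ∘ real? G)) classReps

  real?-resp-Conj : ∀ {g h} → Conj G g h → T (real? G g) → T (real? G h)
  real?-resp-Conj g~h = conj?-complete ∘ Real-resp-Conj g~h ∘ conj?-sound

  ∈-realReps⁺ : ∀ {g} → Real g → g ∈ realReps
  ∈-realReps⁺ {g} g-real =
    ∈-filter⁺ conjSetoid (T? ∘ real? G) real?-resp-Conj (∈-classReps g) (conj?-complete g-real)

  ∈-realReps⁻ : ∀ {g} → g ∈ realReps → Real g
  ∈-realReps⁻ = conj?-sound ∘ proj₂ ∘ ∈-filter⁻ conjSetoid (T? ∘ real? G) real?-resp-Conj {xs = classReps}

  c≡length : ∀ {L} → Unique L → (∀ g → g ∈ L) → c G ≡ length L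
  c≡length L! ∈-L =
    Unique-⊆-⊇⇒length≡ conjSetoid classReps-unique L! (λ {g} _ → ∈-L g) (λ {g} _ → ∈-classReps g)

  c₂≡length : ∀ {L} → Unique L → (∀ {g} → g ∈ L → Real g) → (∀ {g} → Real g → g ∈ L) → c₂ G ≡ length L
  c₂≡length L! ∈-L⁻ ∈-L⁺ = Unique-⊆-⊇⇒length≡ conjSetoid (filter⁺ conjSetoid _ classReps-unique) L!
    (∈-L⁺ ∘ ∈-realReps⁻) (∈-realReps⁺ ∘ ∈-L⁻)

  c≡c₂+|nonrealReps| : c G ≡ c₂ G + length nonrealReps
  c≡c₂+|nonrealReps| = ≡.sym (length-filter+filter-∁ (T? ∘ real? G) classReps)

  2∣|nonrealReps| : 2 ∣ length nonrealReps
  2∣|nonrealReps| = Unique-involution-closed⇒2∣length conjSetoid Conj-⁻¹ (λ g → ≈⇒Conj (⁻¹-involutive g))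
    (filter⁺ conjSetoid _ classReps-unique) fixedPointFree closed
    where
    nonreal-resp-Conj : ∀ {g h} → Conj G g h → ¬ T (real? G g) → ¬ T (real? G h)
    nonreal-resp-Conj g~h g-nonreal = g-nonreal ∘ real?-resp-Conj (Conj-sym g~h)
    ∈-nonrealReps⁻ : ∀ {g} → g ∈ nonrealReps → ¬ Real g
    ∈-nonrealReps⁻ g∈ =
      proj₂ (∈-filter⁻ conjSetoid (∁? (T? ∘ real? G)) nonreal-resp-Conj {xs = classReps} g∈) ∘ conj?-complete
    fixedPointFree : ∀ {g} → g ∈ nonrealReps → ¬ Conj G (g ⁻¹) g
    fixedPointFree g∈ g⁻¹~g = ∈-nonrealReps⁻ g∈ (Conj-sym g⁻¹~g)
    closed : ∀ {g} → g ∈ nonrealReps → g ⁻¹ ∈ nonrealReps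
    closed {g} g∈ = ∈-filter⁺ conjSetoid _ nonreal-resp-Conj (∈-classReps (g ⁻¹))
      (∈-nonrealReps⁻ g∈ ∘ Real-⁻¹ ∘ conj?-sound)

  1≤c : 1 ≤ c G
  1≤c = ∈-length conjSetoid (∈-classReps ε)

module _ {a b} (G : FiniteGroup a b) where
  open Conjugacy G

  c+c₂≡2*[kstar+1] : c G + c₂ G ≡ 2 * (kstar G + 1)
  c+c₂≡2*[kstar+1] with 2∣|nonrealReps|
  ... | divides q |nonreal|≡q*2 = begin
    c G + c₂ G        ≡⟨ c+c₂≡n*2 ⟩
    n * 2             ≡⟨ *-comm n 2 ⟩
    2 * n             ≡⟨ ≡.cong (2 *_) kstar+1≡n ⟨
    2 * (kstar G + 1) ∎
    where
    open ≡-Reasoning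
    n = c₂ G + q
    x+y*2+x≡[x+y]*2 : ∀ x y → x + y * 2 + x ≡ (x + y) * 2
    x+y*2+x≡[x+y]*2 = solve-∀
    c+c₂≡n*2 : c G + c₂ G ≡ n * 2
    c+c₂≡n*2 = begin
      c G + c₂ G                       ≡⟨ ≡.cong (_+ c₂ G) c≡c₂+|nonrealReps| ⟩
      c₂ G + length nonrealReps + c₂ G ≡⟨ ≡.cong (λ m → c₂ G + m + c₂ G) |nonreal|≡q*2 ⟩
      c₂ G + q * 2 + c₂ G              ≡⟨ x+y*2+x≡[x+y]*2 (c₂ G) q ⟩
      n * 2                            ∎
    kstar+1≡n : kstar G + 1 ≡ n
    kstar+1≡n = m≡n*2⇒m/2∸1+1≡n n c+c₂≡n*2 (≤-trans 1≤c (m≤m+n _ _))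

  c₂≡c : Ambivalent G → c₂ G ≡ c G
  c₂≡c amb = c₂≡length classReps-unique (λ {g} _ → amb g) (λ {g} _ → ∈-classReps g)

  kstar+1≡c : Ambivalent G → kstar G + 1 ≡ c G
  kstar+1≡c amb = *-cancelˡ-≡ (kstar G + 1) (c G) 2 (begin
    2 * (kstar G + 1) ≡⟨ c+c₂≡2*[kstar+1] ⟨
    c G + c₂ G        ≡⟨ ≡.cong (c G +_) (c₂≡c amb) ⟩
    c G + c G         ≡⟨ ≡.cong (c G +_) (+-identityʳ (c G)) ⟨
    2 * c G           ∎)
    where open ≡-Reasoning

module _ {a b a′ b′} (G : FiniteGroup a b) (A : FiniteGroup a′ b′) where
  private
    module G = Conjugacy G
    module A = Conjugacy A
    module GA = Conjugacy (G ×ᶠ A)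

  Conj-×⁺ : ∀ {g h x y} → Conj G g h → Conj A x y → Conj (G ×ᶠ A) (g , x) (h , y)
  Conj-×⁺ (u , e) (v , f) = (u , v) , (e , f)

  Conj-×⁻ : ∀ {g h x y} → Conj (G ×ᶠ A) (g , x) (h , y) → Conj G g h × Conj A x y
  Conj-×⁻ ((u , v) , (e , f)) = (u , e) , (v , f)

  private
    ∈-× : ∀ {xs ys g x} → g G.∈ xs → x A.∈ ys → (g , x) GA.∈ cartesianProduct xs ys
    ∈-× = ∈-cartesianProductWith⁺ G.conjSetoid A.conjSetoid GA.conjSetoid Conj-×⁺

    Unique-× : ∀ {xs ys} → G.Unique xs → A.Unique ys → GA.Unique (cartesianProduct xs ys)
    Unique-× = cartesianProductWith⁺ G.conjSetoid A.conjSetoid GA.conjSetoid _,_ Conj-×⁻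

  c-× : c (G ×ᶠ A) ≡ c G * c A
  c-× = ≡.trans (GA.c≡length (Unique-× G.classReps-unique A.classReps-unique)
                           (λ (g , x) → ∈-× (G.∈-classReps g) (A.∈-classReps x)))
              (length-cartesianProduct G.classReps A.classReps)

  c₂-× : Ambivalent A → c₂ (G ×ᶠ A) ≡ c₂ G * c A
  c₂-× amb = ≡.trans (GA.c₂≡length (Unique-× (filter⁺ G.conjSetoid _ G.classReps-unique) A.classReps-unique)
                                    ∈⇒Real Real⇒∈)
                   (length-cartesianProduct G.realReps A.classReps)
    where
    ∈⇒Real : ∀ {z} → z GA.∈ cartesianProduct G.realReps A.classReps → GA.Real z
    ∈⇒Real z∈ with ∈-cartesianProductWith⁻ G.conjSetoid A.conjSetoid GA.conjSetoid _,_ G.realReps A.classReps z∈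
    ... | g , x , g∈ , _ , z~gx = GA.Real-resp-Conj (GA.Conj-sym z~gx) (Conj-×⁺ (G.∈-realReps⁻ g∈) (amb x))
    Real⇒∈ : ∀ {z} → GA.Real z → z GA.∈ cartesianProduct G.realReps A.classReps
    Real⇒∈ {g , x} z-real = ∈-× (G.∈-realReps⁺ (proj₁ (Conj-×⁻ z-real))) (A.∈-classReps x)

kstar-× : ∀ {a b a′ b′} (G : FiniteGroup a b) (A : FiniteGroup a′ b′) → Ambivalent A →
          kstar (G ×ᶠ A) + 1 ≡ (kstar A + 1) * (kstar G + 1)
kstar-× G A amb = *-cancelˡ-≡ _ _ 2 (begin
  2 * (kstar (G ×ᶠ A) + 1)          ≡⟨ c+c₂≡2*[kstar+1] (G ×ᶠ A) ⟨
  c (G ×ᶠ A) + c₂ (G ×ᶠ A)          ≡⟨ ≡.cong₂ _+_ (c-× G A) (c₂-× G A amb) ⟩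
  c G * c A + c₂ G * c A            ≡⟨ *-distribʳ-+ (c A) (c G) (c₂ G) ⟨
  (c G + c₂ G) * c A                ≡⟨ ≡.cong (_* c A) (c+c₂≡2*[kstar+1] G) ⟩
  2 * (kstar G + 1) * c A           ≡⟨ *-assoc 2 (kstar G + 1) (c A) ⟩
  2 * ((kstar G + 1) * c A)         ≡⟨ ≡.cong (2 *_) (*-comm (kstar G + 1) (c A)) ⟩
  2 * (c A * (kstar G + 1))         ≡⟨ ≡.cong (λ n → 2 * (n * (kstar G + 1))) (kstar+1≡c A amb) ⟨
  2 * ((kstar A + 1) * (kstar G + 1)) ∎)
  where open ≡-Reasoning

Ambivalent-ℤ₂^ : ∀ r → Ambivalent (ℤ₂^ r)
Ambivalent-ℤ₂^ zero    _       = Conjugacy.Conj-refl trivialGroup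
Ambivalent-ℤ₂^ (suc r) (g , x) = Conj-×⁺ ℤ₂ (ℤ₂^ r) (Conjugacy.Conj-refl ℤ₂) (Ambivalent-ℤ₂^ r x)

c-ℤ₂^ : ∀ r → c (ℤ₂^ r) ≡ 2 ^ r
c-ℤ₂^ zero    = ≡.refl
c-ℤ₂^ (suc r) = ≡.trans (c-× ℤ₂ (ℤ₂^ r)) (≡.cong (2 *_) (c-ℤ₂^ r))

lemma6p7 : ∀ {c ℓ c′ ℓ′ : Level} →
           ((G : FiniteGroup c ℓ) (A : FiniteGroup c′ ℓ′) →
             Ambivalent A →
             kstar (G ×ᶠ A) ≡ (kstar A + 1) * (kstar G + 1) ∸ 1)
           × ((G : FiniteGroup c ℓ) (r : ℕ) →
             kstar (G ×ᶠ (ℤ₂^ r)) ≡ 2 ^ r * (kstar G + 1) ∸ 1)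
lemma6p7 = (λ G A amb → m+1≡n⇒m≡n∸1 (kstar-× G A amb))
         , (λ G r → m+1≡n⇒m≡n∸1 (≡.trans (kstar-× G (ℤ₂^ r) (Ambivalent-ℤ₂^ r))
                                    (≡.cong (_* (kstar G + 1))
                                      (≡.trans (kstar+1≡c (ℤ₂^ r) (Ambivalent-ℤ₂^ r)) (c-ℤ₂^ r)))))
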